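{- Let $n\ge3$, $k\ge0$ with $n\le k$. Let $S$ be an independent, non-reversible set in $G_n^k$ which contains a strict alternating cycle $\{(x_\alpha,y_\alpha):\alpha\in[3]\}$ of size $3$ with the Disjoint Property, with $x_1=a_1$ and $y_3=b_{k+2}$. If $A(S)\subseteq\{a_1,\dots,a_{k+2}\}$ and $B(S)\subseteq\{b_1,\dots,b_{k+2}\}$, then $|S|\le (k+1)(k+2)/2+2-n$.
   Context: The crown $S_n^k$ is the height-2 poset on $A\cup B$, $A=\{a_1,\dots,a_{n+k}\}$ minimal, $B=\{b_1,\dots,b_{n+k}\}$ maximal, indices cyclic mod $n+k$; $a_i$ is incomparable to $b_j$ iff $j\in\{i,\dots,i+k\}$ (mod $n+k$), otherwise $a_i<b_j$. $\mathrm{Inc}(A,B)$: incomparable pairs $(a,b)\in A\times B$; $G_n^k$: graph on $\mathrm{Inc}(A,B)$ with $(a,b)\sim(x,y)$ iff $a<y$ and $x<b$. $S\subseteq\mathrm{Inc}(A,B)$ is reversible if some linear extension $L$ of $S_n^k$ has $x>y$ in $L$ for all $(x,y)\in S$. Place points $u_1,\dots,u_{n+k}$ clockwise on a circle, with $a_i$ and $b_i$ both at $u_i$; $v_1\preceq\cdots\preceq v_\ell$ means traversing clockwise from the position of $v_1$ to the first arrival at the position of $v_\ell$ visits the positions of $v_2,\dots,v_{\ell-1}$ in order, $\preceq$ allowing equal positions, $\prec$ requiring distinct ones. An indexed set $\{(x_\alpha,y_\alpha):\alpha\in[m]\}\subseteq\mathrm{Inc}(A,B)$ is an alternating cycle if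 $x_\alpha\le y_{\alpha-1}$ (indices mod $m$); strict if $x_\alpha\le y_\beta$ iff $\beta=\alpha-1$; a strict alternating cycle of size 3 so labeled has the Disjoint Property if $x_1\preceq y_1\prec x_2\preceq y_2\prec x_3\preceq y_3$. $A(S)=\{a:(a,b)\in S\text{ for some }b\}$, $B(S)=\{b:(a,b)\in S\text{ for some }a\}$. -}

module Defs where

open import Data.Nat using (ℕ; zero; suc; _+_; _∸_; _≤_; _<_; _≤ᵇ_)
open import Data.Bool using (if_then_else_)
open import Data.Fin using (Fin; toℕ)
open import Data.Sum using (_⊎_; inj₁; inj₂)
open import Data.Product using (_×_; _,_; Σ)
open import Data.Empty using (⊥)
open import Data.List using (List)
open import Data.List.Membership.Propositional using (_∈_)
open import Data.List.Relation.Unary.All using (All)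
open import Relation.Nullary using (¬_)
open import Relation.Binary.PropositionalEquality using (_≡_)
open import Function.Definitions using (Injective)

-- The crown S_n^k.  Indices are 0-based: the element a_i (resp. b_i) of the
-- paper, 1 ≤ i ≤ n+k, is represented by the index i-1 : Fin (n+k).
module Crown (n k : ℕ) where

  N : ℕ
  N = n + k

  Idx : Set
  Idx = Fin N

  cdist : Idx → Idx → ℕ
  cdist p q = if toℕ p ≤ᵇ toℕ q then toℕ q ∸ toℕ p else (N + toℕ q) ∸ toℕ p

  -- a_i is incomparable to b_j iff j ∈ {i, …, i+k} (mod N)
  Inc : Idx → Idx → Set
  Inc i j = cdist i j ≤ k

  Comp : Idx → Idx → Set
  Comp i j = ¬ Inc i j

  -- elements of the crown: inj₁ i = a_i, inj₂ j = b_j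
  Elem : Set
  Elem = Idx ⊎ Idx

  _<P_ : Elem → Elem → Set
  inj₁ i <P inj₂ j = Comp i j
  inj₁ i <P inj₁ j = ⊥
  inj₂ i <P _      = ⊥

  -- a linear extension, given by an injective rank function (a linear order
  -- on the finite set Elem) respecting the crown order
  LinExt : (Elem → ℕ) → Set
  LinExt f = Injective _≡_ _≡_ f × (∀ x y → x <P y → f x < f y)

  -- pairs (i , j) stand for (a_i , b_j)
  Pair : Set
  Pair = Idx × Idx

  -- a subset of Inc(A,B), given as a duplicate-free list of incomparable pairs
  -- (duplicate-freeness is imposed in the statement)
  Reversible : List Pair → Set
  Reversible S = Σ (Elem → ℕ) λ f → LinExt f ×
    (∀ i j → (i , j) ∈ S → f (inj₂ j) < f (inj₁ i))

  Adj : Pair → Pair → Set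
  Adj (a , b) (x , y) = Comp a y × Comp x b

  Independent : List Pair → Set
  Independent S = ∀ p q → p ∈ S → q ∈ S → ¬ Adj p q

  -- {(x_α,y_α) : α ∈ [3]} (labeled as given) is a strict alternating cycle:
  -- x_α ≤ y_β iff β = α - 1 (mod 3).  For x ∈ A, y ∈ B, x ≤ y iff x < y.
  StrictAltCycle3 : Idx → Idx → Idx → Idx → Idx → Idx → Set
  StrictAltCycle3 x₁ y₁ x₂ y₂ x₃ y₃ =
    Comp x₁ y₃ × Comp x₂ y₁ × Comp x₃ y₂ ×
    Inc x₁ y₁ × Inc x₁ y₂ × Inc x₂ y₂ × Inc x₂ y₃ × Inc x₃ y₃ × Inc x₃ y₁

  -- Disjoint Property  x₁ ⪯ y₁ ≺ x₂ ⪯ y₂ ≺ x₃ ⪯ y₃ : walking clockwise from the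
  -- position of x₁, the positions are met in this order (weakly for ⪯,
  -- strictly for ≺), i.e. the clockwise distances from x₁ are
  -- non-decreasing / increasing along the chain.
  Disjoint : Idx → Idx → Idx → Idx → Idx → Idx → Set
  Disjoint x₁ y₁ x₂ y₂ x₃ y₃ =
    cdist x₁ x₁ ≤ cdist x₁ y₁ × cdist x₁ y₁ < cdist x₁ x₂ ×
    cdist x₁ x₂ ≤ cdist x₁ y₂ × cdist x₁ y₂ < cdist x₁ x₃ ×
    cdist x₁ x₃ ≤ cdist x₁ y₃

-- Every pair of S lies in the box of positions 0 … k + 1.  An inner pair (i + 1 , j), with
-- j ≤ k, has i ≠ j, and two inner pairs share the unordered pair {i , j} only when they are
-- (i + 1 , j) and (j + 1 , i), which are adjacent in G; so the triangular numbering of {i , j}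
-- separates them using (k + 1) k / 2 numbers.  A boundary pair (0 , j) or (i + 1 , k + 1) is
-- independent of (x₁ , y₁) = (0 , y) and (x₃ , y₃) = (z , k + 1), which pushes it below or
-- above a gap of width n; numbering it by j + n, j + 2, i + n or i + 2 accordingly, two boundary
-- pairs collide only when they are adjacent.  The numbers used form an interval of length
-- (k + 1) (k + 2) / 2 + 2 − n.
module Submission where

open import Defs
open import Data.Nat using (ℕ; zero; suc; _+_; _*_; _∸_; _≤_; _<_; _/_; _⊔_; _⊓_;
  z≤n; s≤s; z<s; _≤?_; _<?_; _≟_)
open import Data.Nat.Properties
open import Data.Nat.DivMod using (m*n/n≡m)
open import Data.Nat.Tactic.RingSolver using (solve-∀)
open import Data.Fin using (Fin; toℕ; fromℕ<) renaming (zero to fzero; suc to fsuc)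
open import Data.Fin.Properties using (toℕ-injective; toℕ-fromℕ<; injective⇒≤)
open import Data.Product using (_×_; _,_; proj₁; proj₂; swap)
open import Data.Sum using (_⊎_; inj₁; inj₂)
open import Data.Empty using (⊥-elim)
open import Data.List using (List; length; lookup)
open import Data.List.Membership.Propositional using (_∈_)
open import Data.List.Membership.Propositional.Properties using (∈-lookup)
open import Data.List.Relation.Unary.All as All using (All)
open import Data.List.Relation.Unary.AllPairs using (_∷_)
open import Data.List.Relation.Unary.Unique.Propositional using (Unique)
open import Relation.Nullary using (¬_; Dec; yes; no)
open import Relation.Nullary.Decidable using (dec-true; dec-false)
open import Relation.Binary.PropositionalEquality
open import Relation.Binary.Definitions using (tri<; tri≈; tri>)

lookup-injective : ∀ {A : Set} {xs : List A} → Unique xs →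
                   ∀ a b → lookup xs a ≡ lookup xs b → a ≡ b
lookup-injective (_ ∷ _)   fzero    fzero    _  = refl
lookup-injective (x∉ ∷ _)  fzero    (fsuc b) eq = ⊥-elim (All.lookup x∉ (∈-lookup b) eq)
lookup-injective (x∉ ∷ _)  (fsuc a) fzero    eq = ⊥-elim (All.lookup x∉ (∈-lookup a) (sym eq))
lookup-injective (_ ∷ xs!) (fsuc a) (fsuc b) eq = cong fsuc (lookup-injective xs! a b eq)

code-injective⇒length≤ : ∀ {A : Set} {xs : List A} {lo hi : ℕ} → Unique xs →
  (code : ∀ {x} → x ∈ xs → ℕ) →
  (∀ {x y} (x∈ : x ∈ xs) (y∈ : y ∈ xs) → code x∈ ≡ code y∈ → x ≡ y) →
  (∀ {x} (x∈ : x ∈ xs) → lo ≤ code x∈ × code x∈ < hi) →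
  length xs ≤ hi ∸ lo
code-injective⇒length≤ {xs = xs} {lo} {hi} xs! code code-inj range = injective⇒≤ f-injective
  where
  f : Fin (length xs) → Fin (hi ∸ lo)
  f a = fromℕ< (∸-monoˡ-< (proj₂ (range (∈-lookup a))) (proj₁ (range (∈-lookup a))))

  f-injective : ∀ {a b} → f a ≡ f b → a ≡ b
  f-injective {a} {b} eq = lookup-injective xs! a b (code-inj _ _
    (∸-cancelʳ-≡ (proj₁ (range (∈-lookup a))) (proj₁ (range (∈-lookup b)))
      (trans (sym (toℕ-fromℕ< _)) (trans (cong toℕ eq) (toℕ-fromℕ< _)))))

1+i≤i+2 : ∀ i → suc i ≤ i + 2
1+i≤i+2 i = ≤-trans (n≤1+n (suc i)) (≤-reflexive (+-comm 2 i))

-- triangular m is the number of pairs a < b < m, and (a , b) ↦ triangular b + a enumerates them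
triangular : ℕ → ℕ
triangular zero    = 0
triangular (suc m) = triangular m + m

triangular-mono-≤ : ∀ {m m′} → m ≤ m′ → triangular m ≤ triangular m′
triangular-mono-≤ z≤n       = z≤n
triangular-mono-≤ (s≤s m≤m′) = +-mono-≤ (triangular-mono-≤ m≤m′) m≤m′

triangular+<triangular : ∀ {a b m} → a < b → b < m → triangular b + a < triangular m
triangular+<triangular {a} {b} a<b b<m =
  <-≤-trans (+-monoʳ-< (triangular b) a<b) (triangular-mono-≤ b<m)

triangular+-injective : ∀ {a b a′ b′} → a < b → a′ < b′ →
  triangular b + a ≡ triangular b′ + a′ → b ≡ b′ × a ≡ a′
triangular+-injective {a} {b} {a′} {b′} a<b a′<b′ eq with <-cmp b b′
... | tri< b<b′ _ _ = ⊥-elim (<⇒≱ (triangular+<triangular a<b b<b′)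
                                  (≤-trans (m≤m+n _ a′) (≤-reflexive (sym eq))))
... | tri≈ _ refl _ = refl , +-cancelˡ-≡ (triangular b) a a′ eq
... | tri> _ _ b′<b = ⊥-elim (<⇒≱ (triangular+<triangular a′<b′ b′<b)
                                  (≤-trans (m≤m+n _ a) (≤-reflexive eq)))

triangular-suc-*2 : ∀ m → triangular (suc m) * 2 ≡ m * suc m
triangular-suc-*2 zero    = refl
triangular-suc-*2 (suc m) = begin
  (triangular (suc m) + suc m) * 2        ≡⟨ *-distribʳ-+ 2 (triangular (suc m)) (suc m) ⟩
  triangular (suc m) * 2 + suc m * 2      ≡⟨ cong (_+ suc m * 2) (triangular-suc-*2 m) ⟩
  m * suc m + suc m * 2                   ≡⟨ expand m ⟩
  suc m * suc (suc m)                     ∎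
  where
  open ≡-Reasoning
  expand : ∀ m → m * suc m + suc m * 2 ≡ suc m * suc (suc m)
  expand = solve-∀

triangular-bound : ∀ k → triangular (suc k) + (suc k + 2) ≡ (k + 1) * (k + 2) / 2 + 2
triangular-bound k = begin
  triangular (suc k) + (suc k + 2)             ≡⟨ +-assoc (triangular (suc k)) (suc k) 2 ⟨
  triangular (suc (suc k)) + 2                 ≡⟨ cong (_+ 2) (m*n/n≡m (triangular (suc (suc k))) 2) ⟨
  triangular (suc (suc k)) * 2 / 2 + 2         ≡⟨ cong half+2 (triangular-suc-*2 (suc k)) ⟩
  suc k * suc (suc k) / 2 + 2                  ≡⟨ cong half+2 (cong₂ _*_ (+-comm 1 k) (+-comm 2 k)) ⟩
  (k + 1) * (k + 2) / 2 + 2                    ∎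
  where
  open ≡-Reasoning
  half+2 : ℕ → ℕ
  half+2 t = t / 2 + 2

⊓<⊔ : ∀ {i j} → i ≢ j → i ⊓ j < i ⊔ j
⊓<⊔ {i} {j} i≢j with <-cmp i j
... | tri< i<j _ _ =
  subst₂ _<_ (sym (m≤n⇒m⊓n≡m (<⇒≤ i<j))) (sym (m≤n⇒m⊔n≡n (<⇒≤ i<j))) i<j
... | tri≈ _ i≡j _ = ⊥-elim (i≢j i≡j)
... | tri> _ _ j<i =
  subst₂ _<_ (sym (m≥n⇒m⊓n≡n (<⇒≤ j<i))) (sym (m≥n⇒m⊔n≡m (<⇒≤ j<i))) j<i

⊔-⊓-determine : ∀ {i j i′ j′} → i ⊔ j ≡ i′ ⊔ j′ → i ⊓ j ≡ i′ ⊓ j′ →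
                (i ≡ i′ × j ≡ j′) ⊎ (i ≡ j′ × j ≡ i′)
⊔-⊓-determine {i} {j} {i′} {j′} ⊔≡ ⊓≡ with ≤-total i j | ≤-total i′ j′
... | inj₁ i≤j | inj₁ i′≤j′ = inj₁
  (trans (sym (m≤n⇒m⊓n≡m i≤j)) (trans ⊓≡ (m≤n⇒m⊓n≡m i′≤j′)) ,
   trans (sym (m≤n⇒m⊔n≡n i≤j)) (trans ⊔≡ (m≤n⇒m⊔n≡n i′≤j′)))
... | inj₁ i≤j | inj₂ j′≤i′ = inj₂
  (trans (sym (m≤n⇒m⊓n≡m i≤j)) (trans ⊓≡ (m≥n⇒m⊓n≡n j′≤i′)) ,
   trans (sym (m≤n⇒m⊔n≡n i≤j)) (trans ⊔≡ (m≥n⇒m⊔n≡m j′≤i′)))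
... | inj₂ j≤i | inj₁ i′≤j′ = inj₂
  (trans (sym (m≥n⇒m⊔n≡m j≤i)) (trans ⊔≡ (m≤n⇒m⊔n≡n i′≤j′)) ,
   trans (sym (m≥n⇒m⊓n≡n j≤i)) (trans ⊓≡ (m≤n⇒m⊓n≡m i′≤j′)))
... | inj₂ j≤i | inj₂ j′≤i′ = inj₁
  (trans (sym (m≥n⇒m⊔n≡m j≤i)) (trans ⊔≡ (m≥n⇒m⊔n≡m j′≤i′)) ,
   trans (sym (m≥n⇒m⊓n≡n j≤i)) (trans ⊓≡ (m≥n⇒m⊓n≡n j′≤i′)))

-- Positions are the toℕ of crown indices; on the box i , j ≤ k + 1 containing S,
-- Comparable i j says exactly that a_i < b_j.
module Positions (n k : ℕ) where

  K : ℕ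
  K = suc k

  Comparable : ℕ → ℕ → Set
  Comparable i j = (j < i × i < j + n) ⊎ (i ≡ 0 × j ≡ K)

  Adjacent : ℕ → ℕ → ℕ → ℕ → Set
  Adjacent i j i′ j′ = Comparable i j′ × Comparable i′ j

module CrownPositions (n k : ℕ) where
  open Crown n k
  open Positions n k

  cdist-≤ : ∀ {p q : Idx} → toℕ p ≤ toℕ q → cdist p q ≡ toℕ q ∸ toℕ p
  cdist-≤ {p} {q} p≤q rewrite dec-true (toℕ p ≤? toℕ q) p≤q = refl

  cdist-> : ∀ {p q : Idx} → toℕ q < toℕ p → cdist p q ≡ N + toℕ q ∸ toℕ p
  cdist-> {p} {q} q<p rewrite dec-false (toℕ p ≤? toℕ q) (<⇒≱ q<p) = refl

  Comp-wrap : ∀ {p q : Idx} → toℕ q < toℕ p → toℕ p < toℕ q + n → Comp p q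
  Comp-wrap {p} {q} q<p p<q+n inc = <⇒≱ k<cdist inc
    where
    k<cdist : k < cdist p q
    k<cdist = subst (k <_) (sym (cdist-> q<p)) (m+n≤o⇒m≤o∸n (suc k)
      (subst (suc k + toℕ p ≤_) (rearrange n k (toℕ q)) (+-monoʳ-< k p<q+n)))
      where
      rearrange : ∀ n k q → k + (q + n) ≡ n + k + q
      rearrange = solve-∀

  Comp-far : ∀ {p q : Idx} → toℕ p ≤ toℕ q → k < toℕ q ∸ toℕ p → Comp p q
  Comp-far p≤q k<q∸p inc = <⇒≱ k<q∸p (subst (_≤ k) (cdist-≤ p≤q) inc)

  Inc-wrap : ∀ {p q : Idx} → toℕ q < toℕ p → Inc p q → toℕ q + n ≤ toℕ p
  Inc-wrap q<p inc = ≮⇒≥ (λ p<q+n → Comp-wrap q<p p<q+n inc)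

  cdist-from-0 : ∀ {p q : Idx} → toℕ p ≡ 0 → cdist p q ≡ toℕ q
  cdist-from-0 {p} {q} p≡0 =
    trans (cdist-≤ (subst (_≤ toℕ q) (sym p≡0) z≤n)) (cong (toℕ q ∸_) p≡0)

  Comparable⇒Comp : ∀ {p q : Idx} → Comparable (toℕ p) (toℕ q) → Comp p q
  Comparable⇒Comp (inj₁ (q<p , p<q+n))   = Comp-wrap q<p p<q+n
  Comparable⇒Comp {p} {q} (inj₂ (p≡0 , q≡K)) = Comp-far (subst (_≤ toℕ q) (sym p≡0) z≤n)
    (subst (k <_) (sym (cong₂ _∸_ q≡K p≡0)) ≤-refl)

  Adjacent⇒Adj : ∀ {p q p′ q′ : Idx} →
                 Adjacent (toℕ p) (toℕ q) (toℕ p′) (toℕ q′) → Adj (p , q) (p′ , q′)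
  Adjacent⇒Adj (p◁q′ , p′◁q) = Comparable⇒Comp p◁q′ , Comparable⇒Comp p′◁q

  Independent⇒¬Adjacent : ∀ {S p q p′ q′} → Independent S → (p , q) ∈ S → (p′ , q′) ∈ S →
                           ¬ Adjacent (toℕ p) (toℕ q) (toℕ p′) (toℕ q′)
  Independent⇒¬Adjacent indep pq∈S p′q′∈S adj = indep _ _ pq∈S p′q′∈S (Adjacent⇒Adj adj)

-- y and z are the positions of y₁ and x₃.
module Encoding (n k y z : ℕ) (2≤n : 2 ≤ n) (y+n≤z : y + n ≤ z) (z≤K : z ≤ suc k) where
  open Positions n k

  1+j<j+n : ∀ j → suc j < j + n
  1+j<j+n j = subst (_≤ j + n) (+-comm j 2) (+-monoʳ-≤ j 2≤n)

  Comparable-suc : ∀ j → Comparable (suc j) j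
  Comparable-suc j = inj₁ (≤-refl , 1+j<j+n j)

  Comparable-of-slot : ∀ {i j} → j + n ≡ i + 2 → Comparable (suc i) j
  Comparable-of-slot {i} {j} eq =
    inj₁ (s≤s (+-cancelʳ-≤ 2 j i (subst (j + 2 ≤_) eq (+-monoʳ-≤ j 2≤n))) ,
          ≤-reflexive (trans (+-comm 2 i) (sym eq)))

  bottom-top-adjacent : ∀ {i j} → Comparable i j → Adjacent 0 j i K
  bottom-top-adjacent i◁j = inj₂ (refl , refl) , i◁j

  n≤z : n ≤ z
  n≤z = m+n≤o⇒n≤o y y+n≤z

  n≤K : n ≤ K
  n≤K = ≤-trans n≤z z≤K

  data Boundary : ℕ → ℕ → Set where
    low-bottom  : ∀ {j} → j + n ≤ z → Boundary 0 j
    high-bottom : ∀ {j} → z ≤ j → j ≤ k → Boundary 0 j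
    low-top     : ∀ {i} → suc i ≤ y → Boundary (suc i) K
    high-top    : ∀ {i} → y + n ≤ suc i → suc i ≤ K → Boundary (suc i) K

  slot : ∀ {i j} → Boundary i j → ℕ
  slot (low-bottom  {j} _)   = j + n
  slot (high-bottom {j} _ _) = j + 2
  slot (low-top     {i} _)   = i + n
  slot (high-top    {i} _ _) = i + 2

  slot-range : ∀ {i j} (b : Boundary i j) → n ≤ slot b × slot b < K + 2
  slot-range (low-bottom {j} j+n≤z) =
    m≤n+m n j , ≤-<-trans (≤-trans j+n≤z z≤K) (m<m+n K z<s)
  slot-range (high-bottom {j} z≤j j≤k) =
    ≤-trans n≤z (≤-trans z≤j (m≤m+n j 2)) , +-monoˡ-< 2 (s≤s j≤k)
  slot-range (low-top {i} i<y) =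
    m≤n+m n i , <-≤-trans (+-monoˡ-< n i<y) (≤-trans y+n≤z (≤-trans z≤K (m≤m+n K 2)))
  slot-range (high-top {i} y+n≤1+i 1+i≤K) =
    ≤-trans (m≤n+m n y) (≤-trans y+n≤1+i (1+i≤i+2 i)) ,
    +-monoˡ-< 2 1+i≤K

  low-top+n≤z : ∀ {i} → suc i ≤ y → i + n ≤ z
  low-top+n≤z i<y = ≤-trans (<⇒≤ (+-monoˡ-< n i<y)) y+n≤z

  ≤z⇒<high-bottom : ∀ {m j} → m ≤ z → z ≤ j → m < j + 2
  ≤z⇒<high-bottom {j = j} m≤z z≤j = ≤-<-trans (≤-trans m≤z z≤j) (m<m+n j z<s)

  low-top<high-top : ∀ {i i′} → suc i ≤ y → y + n ≤ suc i′ → i + n < i′ + 2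
  low-top<high-top {i′ = i′} i<y y+n≤1+i′ =
    <-≤-trans (+-monoˡ-< n i<y) (≤-trans y+n≤1+i′ (1+i≤i+2 i′))

  slot-injective : ∀ {i j i′ j′} (b : Boundary i j) (b′ : Boundary i′ j′) →
                   ¬ Adjacent i j i′ j′ → slot b ≡ slot b′ → i ≡ i′ × j ≡ j′
  slot-injective (low-bottom {j} _) (low-bottom {j′} _) _ eq = refl , +-cancelʳ-≡ n j j′ eq
  slot-injective (low-bottom j+n≤z) (high-bottom z≤j′ _) _ eq =
    ⊥-elim (<⇒≢ (≤z⇒<high-bottom j+n≤z z≤j′) eq)
  slot-injective (low-bottom {j} _) (low-top {i′} _) ¬adj eq with +-cancelʳ-≡ n j i′ eq
  ... | refl = ⊥-elim (¬adj (bottom-top-adjacent (Comparable-suc j)))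
  slot-injective (low-bottom _) (high-top _ _) ¬adj eq =
    ⊥-elim (¬adj (bottom-top-adjacent (Comparable-of-slot eq)))
  slot-injective (high-bottom z≤j _) (low-bottom j′+n≤z) _ eq =
    ⊥-elim (<⇒≢ (≤z⇒<high-bottom j′+n≤z z≤j) (sym eq))
  slot-injective (high-bottom {j} _ _) (high-bottom {j′} _ _) _ eq = refl , +-cancelʳ-≡ 2 j j′ eq
  slot-injective (high-bottom z≤j _) (low-top i′<y) _ eq =
    ⊥-elim (<⇒≢ (≤z⇒<high-bottom (low-top+n≤z i′<y) z≤j) (sym eq))
  slot-injective (high-bottom {j} _ _) (high-top {i′} _ _) ¬adj eq with +-cancelʳ-≡ 2 j i′ eq
  ... | refl = ⊥-elim (¬adj (bottom-top-adjacent (Comparable-suc j)))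
  slot-injective (low-top {i} _) (low-bottom {j′} _) ¬adj eq with +-cancelʳ-≡ n i j′ eq
  ... | refl = ⊥-elim (¬adj (swap (bottom-top-adjacent (Comparable-suc i))))
  slot-injective (low-top i<y) (high-bottom z≤j′ _) _ eq =
    ⊥-elim (<⇒≢ (≤z⇒<high-bottom (low-top+n≤z i<y) z≤j′) eq)
  slot-injective (low-top {i} _) (low-top {i′} _) _ eq = cong suc (+-cancelʳ-≡ n i i′ eq) , refl
  slot-injective (low-top i<y) (high-top y+n≤1+i′ _) _ eq =
    ⊥-elim (<⇒≢ (low-top<high-top i<y y+n≤1+i′) eq)
  slot-injective (high-top _ _) (low-bottom _) ¬adj eq =
    ⊥-elim (¬adj (swap (bottom-top-adjacent (Comparable-of-slot (sym eq)))))
  slot-injective (high-top {i} _ _) (high-bottom {j′} _ _) ¬adj eq with +-cancelʳ-≡ 2 i j′ eq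
  ... | refl = ⊥-elim (¬adj (swap (bottom-top-adjacent (Comparable-suc i))))
  slot-injective (high-top y+n≤1+i _) (low-top i′<y) _ eq =
    ⊥-elim (<⇒≢ (low-top<high-top i′<y y+n≤1+i) (sym eq))
  slot-injective (high-top {i} _ _) (high-top {i′} _ _) _ eq = cong suc (+-cancelʳ-≡ 2 i i′ eq) , refl

  data Kind : ℕ → ℕ → Set where
    inner    : ∀ {i j} → i ≢ j → i ≤ k → j ≤ k → Kind (suc i) j
    boundary : ∀ {i j} → Boundary i j → Kind i j

  code : ∀ {i j} → Kind i j → ℕ
  code (inner {i} {j} _ _ _) = triangular (i ⊔ j) + i ⊓ j + n
  code (boundary b)          = triangular K + slot b

  inner-code< : ∀ {i j} → i ≢ j → i ≤ k → j ≤ k →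
                triangular (i ⊔ j) + i ⊓ j < triangular K
  inner-code< i≢j i≤k j≤k = triangular+<triangular (⊓<⊔ i≢j) (s≤s (⊔-lub i≤k j≤k))

  code-range : ∀ {i j} (c : Kind i j) → n ≤ code c × code c < triangular K + (K + 2)
  code-range (inner i≢j i≤k j≤k) =
    m≤n+m n _ , +-mono-<-≤ (inner-code< i≢j i≤k j≤k) (≤-trans n≤K (m≤m+n K 2))
  code-range (boundary b) =
    ≤-trans (proj₁ (slot-range b)) (m≤n+m _ (triangular K)) ,
    +-monoʳ-< (triangular K) (proj₂ (slot-range b))

  code-injective : ∀ {i j i′ j′} (c : Kind i j) (c′ : Kind i′ j′) →
                   ¬ Adjacent i j i′ j′ → code c ≡ code c′ → i ≡ i′ × j ≡ j′
  code-injective (inner {i} {j} i≢j _ _) (inner {i′} {j′} i′≢j′ _ _) ¬adj eq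
    with triangular+-injective (⊓<⊔ i≢j) (⊓<⊔ i′≢j′) (+-cancelʳ-≡ n _ _ eq)
  ... | ⊔≡ , ⊓≡ with ⊔-⊓-determine ⊔≡ ⊓≡
  ...   | inj₁ (refl , refl) = refl , refl
  ...   | inj₂ (refl , refl) = ⊥-elim (¬adj (Comparable-suc i , Comparable-suc j))
  code-injective (inner i≢j i≤k j≤k) (boundary b′) _ eq =
    ⊥-elim (<⇒≢ (+-mono-<-≤ (inner-code< i≢j i≤k j≤k) (proj₁ (slot-range b′))) eq)
  code-injective (boundary b) (inner i′≢j′ i′≤k j′≤k) _ eq =
    ⊥-elim (<⇒≢ (+-mono-<-≤ (inner-code< i′≢j′ i′≤k j′≤k) (proj₁ (slot-range b))) (sym eq))
  code-injective (boundary b) (boundary b′) ¬adj eq =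
    slot-injective b b′ ¬adj (+-cancelˡ-≡ (triangular K) _ _ eq)

  classify : ∀ {i j} → i ≤ K → j ≤ K → (i ≡ 0 → j ≤ k) → (j < i → j + n ≤ i) →
             ¬ Adjacent 0 y i j → ¬ Adjacent i j z K → Kind i j
  classify {zero} {j} _ _ j≤k _ _ ¬adj-z with j + n ≤? z | j <? z
  ... | yes j+n≤z | _         = boundary (low-bottom j+n≤z)
  ... | no j+n≰z  | yes j<z   = ⊥-elim (¬adj-z (inj₂ (refl , refl) , inj₁ (j<z , ≰⇒> j+n≰z)))
  ... | no _      | no j≮z    = boundary (high-bottom (≮⇒≥ j≮z) (j≤k refl))
  classify {suc i} {j} 1+i≤K j≤K _ wrap ¬adj-y _ with j ≟ K
  ... | yes refl = top (suc i ≤? y) (suc i <? y + n)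
    where
    top : Dec (suc i ≤ y) → Dec (suc i < y + n) → Kind (suc i) K
    top (yes 1+i≤y) _            = boundary (low-top 1+i≤y)
    top (no 1+i≰y)  (yes 1+i<y+n) =
      ⊥-elim (¬adj-y (inj₂ (refl , refl) , inj₁ (≰⇒> 1+i≰y , 1+i<y+n)))
    top (no _)      (no 1+i≮y+n) = boundary (high-top (≮⇒≥ 1+i≮y+n) 1+i≤K)
  ... | no j≢K with i ≟ j
  ...   | yes refl = ⊥-elim (<⇒≱ (1+j<j+n i) (wrap ≤-refl))
  ...   | no i≢j   = inner i≢j (≤-pred 1+i≤K) (≤-pred (≤∧≢⇒< j≤K j≢K))

independent-length≤ : ∀ n k → 2 ≤ n → (S : List (Crown.Pair n k)) → Unique S →
  All (λ p → Crown.Inc n k (proj₁ p) (proj₂ p)) S → Crown.Independent n k S →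
  ∀ {x₁ y₁ x₃ y₃} → (x₁ , y₁) ∈ S → (x₃ , y₃) ∈ S →
  toℕ x₁ ≡ 0 → toℕ y₃ ≡ k + 1 → toℕ y₁ + n ≤ toℕ x₃ →
  (∀ i j → (i , j) ∈ S → toℕ i ≤ k + 1 × toℕ j ≤ k + 1) →
  length S ≤ triangular (suc k) + (suc k + 2) ∸ n
independent-length≤ n k 2≤n S S! incS indep {y₁ = y₁} {x₃ = x₃}
                    x₁y₁∈S x₃y₃∈S x₁≡0 y₃≡k+1 y₁+n≤x₃ bounds =
  code-injective⇒length≤ S! codeS codeS-injective (λ pq∈S → code-range (kind pq∈S))
  where
  open Crown n k
  open Positions n k
  open CrownPositions n k

  in-box : ∀ {p q} → (p , q) ∈ S → toℕ p ≤ K × toℕ q ≤ K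
  in-box {p} {q} pq∈S with bounds p q pq∈S
  ... | p≤k+1 , q≤k+1 =
    subst (toℕ p ≤_) (+-comm k 1) p≤k+1 , subst (toℕ q ≤_) (+-comm k 1) q≤k+1

  open Encoding n k (toℕ y₁) (toℕ x₃) 2≤n y₁+n≤x₃ (proj₁ (in-box x₃y₃∈S))

  kind : ∀ {p q} → (p , q) ∈ S → Kind (toℕ p) (toℕ q)
  kind {p} {q} pq∈S = classify (proj₁ (in-box pq∈S)) (proj₂ (in-box pq∈S))
    (λ p≡0 → subst (_≤ k) (cdist-from-0 p≡0) inc)
    (λ q<p → Inc-wrap q<p inc)
    (subst (λ i → ¬ Adjacent i _ _ _) x₁≡0 (Independent⇒¬Adjacent indep x₁y₁∈S pq∈S))
    (subst (λ j → ¬ Adjacent _ _ _ j) (trans y₃≡k+1 (+-comm k 1))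
      (Independent⇒¬Adjacent indep pq∈S x₃y₃∈S))
    where
    inc : Inc p q
    inc = All.lookup incS pq∈S

  codeS : ∀ {pq} → pq ∈ S → ℕ
  codeS pq∈S = code (kind pq∈S)

  codeS-injective : ∀ {pq p′q′} (pq∈S : pq ∈ S) (p′q′∈S : p′q′ ∈ S) →
                    codeS pq∈S ≡ codeS p′q′∈S → pq ≡ p′q′
  codeS-injective pq∈S p′q′∈S eq
    with code-injective (kind pq∈S) (kind p′q′∈S) (Independent⇒¬Adjacent indep pq∈S p′q′∈S) eq
  ... | p≡p′ , q≡q′ = cong₂ _,_ (toℕ-injective p≡p′) (toℕ-injective q≡q′)

lemma6p7 : (n k : ℕ) → 3 ≤ n → n ≤ k →
    (S : List (Crown.Pair n k)) → Unique S →
    All (λ p → Crown.Inc n k (proj₁ p) (proj₂ p)) S →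
    Crown.Independent n k S → ¬ Crown.Reversible n k S →
    (x₁ y₁ x₂ y₂ x₃ y₃ : Crown.Idx n k) →
    (x₁ , y₁) ∈ S → (x₂ , y₂) ∈ S → (x₃ , y₃) ∈ S →
    Crown.StrictAltCycle3 n k x₁ y₁ x₂ y₂ x₃ y₃ →
    Crown.Disjoint n k x₁ y₁ x₂ y₂ x₃ y₃ →
    toℕ x₁ ≡ 0 → toℕ y₃ ≡ k + 1 →
    (∀ i j → (i , j) ∈ S → toℕ i ≤ k + 1 × toℕ j ≤ k + 1) →
    length S ≤ ((k + 1) * (k + 2)) / 2 + 2 ∸ n
lemma6p7 n k 3≤n _ S S! incS indep _ x₁ y₁ x₂ y₂ x₃ y₃ x₁y₁∈S _ x₃y₃∈S
  (_ , _ , _ , _ , _ , _ , _ , _ , inc-x₃y₁) (_ , y₁<x₂ , x₂≤y₂ , y₂<x₃ , _) x₁≡0 y₃≡k+1 bounds =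
  subst (λ b → length S ≤ b ∸ n) (triangular-bound k)
    (independent-length≤ n k (<⇒≤ 3≤n) S S! incS indep x₁y₁∈S x₃y₃∈S x₁≡0 y₃≡k+1 y₁+n≤x₃ bounds)
  where
  open CrownPositions n k

  y₁<x₃ : toℕ y₁ < toℕ x₃
  y₁<x₃ = subst₂ _<_ (cdist-from-0 x₁≡0) (cdist-from-0 x₁≡0)
            (<-trans y₁<x₂ (≤-<-trans x₂≤y₂ y₂<x₃))

  y₁+n≤x₃ : toℕ y₁ + n ≤ toℕ x₃
  y₁+n≤x₃ = Inc-wrap y₁<x₃ inc-x₃y₁
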